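{- Let $D$ be a diagram. If $\tilde E_c(D)\ne0$, then for every row index $r\ge1$, $\tilde e_r(D)\ne0$ if and only if $\tilde e_r(\tilde E_c(D))\neq0$. Likewise, if $\tilde e_r(D)\neq0$, then for every column index $c\ge1$, $\tilde E_c(D)\neq0$ if and only if $\tilde E_c(\tilde e_r(D))\neq0$. Moreover, $\tilde E_c(\tilde e_r(D))=\tilde e_r(\tilde E_c(D))$ whenever $\tilde E_c(D)\neq0$ and $\tilde e_r(D)\ne0$.
   Context: A diagram is a finite set of cells $(r,c)$ with $r,c\ge1$ (row $r$, column $c$). Vertical $i$-pairing: pair cells in rows $i$ and $i+1$ lying in the same column; then iteratively pair an unpaired cell in row $i+1$ with an unpaired cell in row $i$ in a column to its left whenever all cells of rows $i$ and $i+1$ in the columns between them are already paired. The raising operator $\tilde e_i$ moves the rightmost vertically unpaired cell of row $i+1$ down to row $i$ (same column), and $\tilde e_i(D)=0$ if row $i+1$ has no vertically unpaired cell. Horizontal $i$-pairing: pair cells in columns $i$ and $i+1$ lying in the same row; then iteratively pair an unpaired cell in column $i+1$ with an unpaired cell in column $i$ in a row above it whenever all cells of columns $i$ and $i+1$ in the rows between them are already paired. The rectification operator $\tilde E_i$ moves the bottom-most horizontally unpaired cell of column $i+1$ left to column $i$ (same row), and $\tilde E_i(D)=0$ if column $i+1$ has no horizontally unpaired cell. -}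

module Defs where

open import Data.Nat using (ℕ; zero; suc; _⊔_; _≤_)
open import Data.Nat.Properties using (_≟_)
open import Data.Bool using (Bool; true; false; _∧_; not)
open import Data.Product using (_×_; _,_; proj₁; proj₂; ∃-syntax)
open import Data.List using (List; []; _∷_; filter; foldr; upTo; reverse; map)
open import Data.List.Membership.Propositional using (_∈_)
open import Data.List.Relation.Unary.All using (All)
open import Data.Maybe using (Maybe; just; nothing)
open import Relation.Nullary.Decidable using (does; ⌊_⌋; ¬?)
open import Relation.Binary.PropositionalEquality using (_≡_)
open import Function.Bundles using (_⇔_)

-- A cell (r , c): row r, column c (rows numbered bottom-up: row i+1 lies above row i).
Cell : Set
Cell = ℕ × ℕ

-- A diagram is a finite set of cells, represented by a list of cells
-- (order and repetitions irrelevant; all operations below only use membership).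
Diagram : Set
Diagram = List Cell

IsDiagram : Diagram → Set
IsDiagram D = All (λ x → 1 ≤ proj₁ x × 1 ≤ proj₂ x) D

_≈D_ : Diagram → Diagram → Set
D ≈D D' = ∀ (x : Cell) → (x ∈ D) ⇔ (x ∈ D')

_≟C_ : (x y : Cell) → Bool
(a , b) ≟C (a' , b') = does (a ≟ a') ∧ does (b ≟ b')

mem : Diagram → Cell → Bool
mem [] x = false
mem (y ∷ D) x with y ≟C x
... | true = true
... | false = mem D x

bound : Diagram → ℕ
bound = foldr (λ x m → proj₁ x ⊔ proj₂ x ⊔ m) 0

moveCell : Cell → Cell → Diagram → Diagram
moveCell x y D = y ∷ filter (λ z → ¬? (Data.Bool._≟_ (z ≟C x) true)) D

-- Bracket scan implementing the iterative pairing.  We scan positions in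
-- order; at each position p, lo p says whether the "lower-index line"
-- (row i / column i) has a cell there, hi p whether the "higher-index
-- line" (row i+1 / column i+1) does.  Positions having both cells are
-- paired with each other.  An unpaired lo-cell opens; an unpaired hi-cell is
-- paired with the most recent still-open lo-cell if there is one, and is
-- unpaired otherwise.  The result is the LAST unpaired hi-cell in scan order.
scan : (ℕ → Bool) → (ℕ → Bool) → ℕ → Maybe ℕ → List ℕ → Maybe ℕ
scan lo hi k0 last [] = last
scan lo hi k0 last (p ∷ ps) with lo p | hi p
... | true  | true  = scan lo hi k0 last ps
... | false | false = scan lo hi k0 last ps
... | true  | false = scan lo hi (suc k0) last ps
... | false | true with k0
...   | zero    = scan lo hi zero (just p) ps
...   | suc k   = scan lo hi k last ps

range : ℕ → List ℕ
range n = map suc (upTo n)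

rightmostUnpairedV : ℕ → Diagram → Maybe ℕ
rightmostUnpairedV i D =
  scan (λ c → mem D (i , c)) (λ c → mem D (suc i , c)) 0 nothing (range (bound D))

-- raising operator ẽ_i (nothing plays the role of 0)
e~ : ℕ → Diagram → Maybe Diagram
e~ i D with rightmostUnpairedV i D
... | nothing = nothing
... | just c  = just (moveCell (suc i , c) (i , c) D)

-- Horizontal i-pairing: scan rows top to bottom (decreasing row index);
-- lo = column i, hi = column i+1 (a column-(i+1) cell pairs with a column-i
-- cell in a row above it).
bottommostUnpairedH : ℕ → Diagram → Maybe ℕ
bottommostUnpairedH i D =
  scan (λ r → mem D (r , i)) (λ r → mem D (r , suc i)) 0 nothing (reverse (range (bound D)))

E~ : ℕ → Diagram → Maybe Diagram
E~ i D with bottommostUnpairedH i D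
... | nothing = nothing
... | just r  = just (moveCell (r , suc i) (r , i) D)

NonZero : Maybe Diagram → Set
NonZero (just _) = Data.Unit.⊤
  where import Data.Unit
NonZero nothing = Data.Empty.⊥
  where import Data.Empty

_>>=D_ : Maybe Diagram → (Diagram → Maybe Diagram) → Maybe Diagram
nothing >>=D f = nothing
just D >>=D f = f D

_≈M_ : Maybe Diagram → Maybe Diagram → Set
just D ≈M just D' = D ≈D D'
nothing ≈M nothing = Data.Unit.⊤
  where import Data.Unit
_ ≈M _ = Data.Empty.⊥
  where import Data.Empty

{-# OPTIONS --safe #-}

-- ẽ_r only reads rows r, r+1 and Ẽ_c only columns c, c+1, each through a bracket scan.
-- Moving a cell with Ẽ_c changes the input of the row scan in columns c, c+1 only (and
-- symmetrically), so for D and for the moved diagram the scans agree before the 2 × 2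
-- block, and after it they act through one threshold and one position. Keeping just the
-- four block cells, the open count clipped at 2 and the threshold shifted and capped
-- accordingly, the two scans, both composites and the cells they move are determined
-- by finitely many data, and all three claims are checked on every such datum.

module Submission where

open import Defs
open import Data.Bool using (Bool; true; false; _∧_; _∨_; not; if_then_else_)
open import Data.Bool.Properties as Bool using (∧-zeroʳ)
open import Data.List as List using (List; []; _∷_; _++_; foldl; foldr; filter; reverse; applyUpTo)
open import Data.List.Properties using (foldl-++; reverse-++; ++-assoc)
open import Data.List.Membership.Propositional using (_∈_)
open import Data.List.Relation.Unary.All as All using (All; []; _∷_)
open import Data.List.Relation.Unary.Any using (here; there)
import Data.List.Relation.Unary.Any.Properties as Any
open import Data.Maybe as Maybe using (Maybe; just; nothing; is-just; fromMaybe)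
open import Data.Maybe.Properties using (map-∘)
import Data.Maybe.Relation.Unary.All as MaybeAll
open import Data.Nat using (ℕ; zero; suc; _+_; _∸_; _⊓_; _⊔_; _≤_; _<_; _<ᵇ_; z≤n; s≤s; pred)
open import Data.Nat.Properties
  using (_≟_; ≤-refl; ≤-trans; <-trans; <⇒≤; <⇒≢; >⇒≢; <⇒≱; n≤1+n; n<1+n;
         m≤m+n; m≤n+m; m≤m⊔n; m≤n⊔m; ⊔-lub; m⊓n≤m; pred[n]≤n; +-suc; +-identityʳ; m+[n∸m]≡n)
open import Data.Product using (Σ; _×_; _,_; proj₁; proj₂)
open import Data.Sum using (_⊎_; inj₁; inj₂)
open import Function using (_∘_; id)
open import Function.Bundles using (_⇔_; mk⇔)
open import Relation.Nullary using (Dec; yes; no; contradiction)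
open import Relation.Nullary.Decidable using (does; dec-true; dec-false; ¬?)
open import Relation.Binary.PropositionalEquality
  using (_≡_; _≢_; refl; sym; trans; cong; cong₂; subst; subst₂; module ≡-Reasoning)

does-sound : ∀ {P : Set} (d : Dec P) → does d ≡ true → P
does-sound (yes p) _ = p

∧-split : ∀ x {y} → x ∧ y ≡ true → x ≡ true × y ≡ true
∧-split true eq = refl , eq

≟C⇒≡ : ∀ {x y : Cell} → x ≟C y ≡ true → x ≡ y
≟C⇒≡ {a , b} {a' , b'} eq with ∧-split (does (a ≟ a')) eq
... | a≡a' , b≡b' = cong₂ _,_ (does-sound (a ≟ a') a≡a') (does-sound (b ≟ b') b≡b')

≟C-refl : ∀ x → x ≟C x ≡ true
≟C-refl (a , b) = cong₂ _∧_ (dec-true (a ≟ a) refl) (dec-true (b ≟ b) refl)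

≟C-sym : ∀ x y → x ≟C y ≡ y ≟C x
≟C-sym (a , b) (a' , b') = cong₂ _∧_ (≟-sym a a') (≟-sym b b')
  where
  ≟-sym : ∀ m n → does (m ≟ n) ≡ does (n ≟ m)
  ≟-sym m n with m ≟ n
  ... | yes m≡n = trans (dec-true (m ≟ n) m≡n) (sym (dec-true (n ≟ m) (sym m≡n)))
  ... | no m≢n  = trans (dec-false (m ≟ n) m≢n) (sym (dec-false (n ≟ m) (m≢n ∘ sym)))

≟C-row : ∀ {a a'} b b' → a ≢ a' → (a , b) ≟C (a' , b') ≡ false
≟C-row {a} {a'} b b' a≢a' = cong (_∧ does (b ≟ b')) (dec-false (a ≟ a') a≢a')

≟C-col : ∀ a a' {b b'} → b ≢ b' → (a , b) ≟C (a' , b') ≡ false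
≟C-col a a' {b} {b'} b≢b' =
  trans (cong (does (a ≟ a') ∧_) (dec-false (b ≟ b') b≢b')) (∧-zeroʳ (does (a ≟ a')))

mem-∷ : ∀ d D z → mem (d ∷ D) z ≡ (d ≟C z) ∨ mem D z
mem-∷ d D z with d ≟C z
... | true  = refl
... | false = refl

mem-filter : ∀ x z D →
  mem (filter (λ w → ¬? ((w ≟C x) Bool.≟ true)) D) z
    ≡ mem D z ∧ not (z ≟C x)
mem-filter x z [] = refl
mem-filter x z (d ∷ D) with d ≟C x in d≟x
... | true with d ≟C z in d≟z
...   | true = begin
  mem (filter _ D) z        ≡⟨ mem-filter x z D ⟩
  mem D z ∧ not (z ≟C x)    ≡⟨ cong (λ b → mem D z ∧ not b) z≟x ⟩
  mem D z ∧ false           ≡⟨ ∧-zeroʳ (mem D z) ⟩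
  false                     ≡⟨ cong not (sym z≟x) ⟩
  not (z ≟C x)              ∎
  where
  open ≡-Reasoning
  z≟x : z ≟C x ≡ true
  z≟x = subst (λ w → w ≟C x ≡ true) (≟C⇒≡ {d} {z} d≟z) d≟x
...   | false = mem-filter x z D
mem-filter x z (d ∷ D) | false with d ≟C z in d≟z
... | true  = cong not (sym (subst (λ w → w ≟C x ≡ false) (≟C⇒≡ {d} {z} d≟z) d≟x))
... | false = mem-filter x z D

mem-moveCell : ∀ x y D z → mem (moveCell x y D) z ≡ (z ≟C y) ∨ (mem D z ∧ not (z ≟C x))
mem-moveCell x y D z =
  trans (mem-∷ y (filter _ D) z) (cong₂ _∨_ (≟C-sym y z) (mem-filter x z D))

mem-moveCell-elsewhere : ∀ x y D z → z ≟C x ≡ false → z ≟C y ≡ false →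
  mem (moveCell x y D) z ≡ mem D z
mem-moveCell-elsewhere x y D z z≢x z≢y rewrite mem-moveCell x y D z | z≢x | z≢y with mem D z
... | true  = refl
... | false = refl

mem⇒∈ : ∀ D z → mem D z ≡ true → z ∈ D
mem⇒∈ (d ∷ D) z eq with d ≟C z in d≟z
... | true  = here (sym (≟C⇒≡ {d} {z} d≟z))
... | false = there (mem⇒∈ D z eq)

∈⇒mem : ∀ D z → z ∈ D → mem D z ≡ true
∈⇒mem (d ∷ D) z (here refl) rewrite mem-∷ z D z | ≟C-refl z = refl
∈⇒mem (d ∷ D) z (there z∈D) rewrite mem-∷ d D z | ∈⇒mem D z z∈D with d ≟C z
... | true  = refl
... | false = refl

≈D-from-mem : ∀ D D' → (∀ z → mem D z ≡ mem D' z) → D ≈D D'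
≈D-from-mem D D' same z =
  mk⇔ (λ z∈D → mem⇒∈ D' z (trans (sym (same z)) (∈⇒mem D z z∈D)))
      (λ z∈D' → mem⇒∈ D z (trans (same z) (∈⇒mem D' z z∈D')))

-- Bracket scans

ScanState : Set → Set
ScanState A = ℕ × Maybe A

scanStep : {A : Set} → Bool → Bool → A → ScanState A → ScanState A
scanStep true  true  p s            = s
scanStep false false p s            = s
scanStep true  false p (k , l)      = suc k , l
scanStep false true  p (zero , l)   = zero , just p
scanStep false true  p (suc k , l)  = k , l

stepAt : (lo hi : ℕ → Bool) → ScanState ℕ → ℕ → ScanState ℕ
stepAt lo hi s p = scanStep (lo p) (hi p) p s

runScan : (lo hi : ℕ → Bool) → ScanState ℕ → List ℕ → ScanState ℕ
runScan lo hi = foldl (stepAt lo hi)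

scan≡runScan : ∀ lo hi k l ps → scan lo hi k l ps ≡ proj₂ (runScan lo hi (k , l) ps)
scan≡runScan lo hi k l [] = refl
scan≡runScan lo hi k l (p ∷ ps) with lo p | hi p
... | true  | true  = scan≡runScan lo hi k l ps
... | false | false = scan≡runScan lo hi k l ps
... | true  | false = scan≡runScan lo hi (suc k) l ps
... | false | true with k
...   | zero   = scan≡runScan lo hi zero (just p) ps
...   | suc k' = scan≡runScan lo hi k' l ps

Agree : (lo hi lo' hi' : ℕ → Bool) → ℕ → Set
Agree lo hi lo' hi' p = lo p ≡ lo' p × hi p ≡ hi' p

Silent : (lo hi : ℕ → Bool) → ℕ → Set
Silent lo hi p = lo p ≡ false × hi p ≡ false

runScan-cong : ∀ {lo hi lo' hi'} s {ps} → All (Agree lo hi lo' hi') ps →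
  runScan lo hi s ps ≡ runScan lo' hi' s ps
runScan-cong s [] = refl
runScan-cong s ((lo≡ , hi≡) ∷ agree) rewrite lo≡ | hi≡ = runScan-cong _ agree

runScan-silent : ∀ {lo hi} s {ps} → All (Silent lo hi) ps → runScan lo hi s ps ≡ s
runScan-silent s [] = refl
runScan-silent s ((lo≡ , hi≡) ∷ silent) rewrite lo≡ | hi≡ = runScan-silent s silent

runScan-All : ∀ {lo hi} {P : ℕ → Set} s {ps} → All P ps → MaybeAll.All P (proj₂ s) →
  MaybeAll.All P (proj₂ (runScan lo hi s ps))
runScan-All s [] Ps = Ps
runScan-All {lo} {hi} {P} (k , l) {p ∷ _} (Pp ∷ Pps) Pl = runScan-All _ Pps (step (lo p) (hi p) k)
  where
  step : ∀ x y k → MaybeAll.All P (proj₂ (scanStep x y p (k , l)))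
  step true  true  k       = Pl
  step false false k       = Pl
  step true  false k       = Pl
  step false true  zero    = MaybeAll.just Pp
  step false true  (suc k) = Pl

fromMaybe-All : ∀ {P : ℕ → Set} {d l} → MaybeAll.All P l → P d → P (fromMaybe d l)
fromMaybe-All (MaybeAll.just Px) _  = Px
fromMaybe-All MaybeAll.nothing   Pd = Pd

-- The suffix of a scan acts on the incoming state (k , l) through a threshold m and a
-- position q, computed by summary: it reports q when k < m and passes l through
-- otherwise (q is the dummy d when m = 0).

resume : {A : Set} → ℕ × A → ScanState A → Maybe A
resume (m , q) (k , l) = if k <ᵇ m then just q else l

summaryStep : Bool → Bool → ℕ → ℕ × ℕ → ℕ × ℕ
summaryStep true  true  p t             = t
summaryStep false false p t             = t
summaryStep true  false p (m , q)       = m ∸ 1 , q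
summaryStep false true  p (zero , q)    = 1 , p
summaryStep false true  p (suc m , q)   = suc (suc m) , q

summary : (lo hi : ℕ → Bool) → ℕ → List ℕ → ℕ × ℕ
summary lo hi d = foldr (λ p → summaryStep (lo p) (hi p) p) (0 , d)

resume-scanStep : ∀ x y p t s →
  resume t (scanStep x y p s) ≡ resume (summaryStep x y p t) s
resume-scanStep true  true  p t s = refl
resume-scanStep false false p t s = refl
resume-scanStep true  false p (zero , q)  (zero , l)  = refl
resume-scanStep true  false p (zero , q)  (suc k , l) = refl
resume-scanStep true  false p (suc m , q) (k , l)     = refl
resume-scanStep false true  p (zero , q)  (zero , l)  = refl
resume-scanStep false true  p (suc m , q) (zero , l)  = refl
resume-scanStep false true  p (zero , q)  (suc zero , l)    = refl
resume-scanStep false true  p (zero , q)  (suc (suc k) , l) = refl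
resume-scanStep false true  p (suc m , q) (suc k , l) = refl

runScan-summary : ∀ lo hi d s ps →
  proj₂ (runScan lo hi s ps) ≡ resume (summary lo hi d ps) s
runScan-summary lo hi d (k , l) [] with k
... | zero  = refl
... | suc _ = refl
runScan-summary lo hi d s (p ∷ ps) =
  trans (runScan-summary lo hi d (stepAt lo hi s p) ps)
        (resume-scanStep (lo p) (hi p) p (summary lo hi d ps) s)

summary-cong : ∀ {lo hi lo' hi'} d {ps} → All (Agree lo hi lo' hi') ps →
  summary lo hi d ps ≡ summary lo' hi' d ps
summary-cong d [] = refl
summary-cong d ((lo≡ , hi≡) ∷ agree) rewrite lo≡ | hi≡ | summary-cong d agree = refl

summary-All : ∀ lo hi {P : ℕ → Set} d {ps} → All P ps → P d → P (proj₂ (summary lo hi d ps))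
summary-All lo hi d [] Pd = Pd
summary-All lo hi {P} d {p ∷ ps} (Pp ∷ Pps) Pd =
  step (lo p) (hi p) (summary lo hi d ps) (summary-All lo hi d Pps Pd)
  where
  step : ∀ x y t → P (proj₂ t) → P (proj₂ (summaryStep x y p t))
  step true  true  t       Pq = Pq
  step false false t       Pq = Pq
  step true  false (m , q) Pq = Pq
  step false true  (zero , q)  Pq = Pp
  step false true  (suc m , q) Pq = Pq

runScan-window : ∀ {lo hi lo' hi'} s u p₁ p₂ v d →
  All (Agree lo hi lo' hi') u → All (Agree lo hi lo' hi') v →
  proj₂ (runScan lo hi s (u ++ p₁ ∷ p₂ ∷ v))
    ≡ resume (summary lo' hi' d v) (stepAt lo hi (stepAt lo hi (runScan lo' hi' s u) p₁) p₂)
runScan-window {lo} {hi} {lo'} {hi'} s u p₁ p₂ v d agreeᵤ agreeᵥ = begin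
  proj₂ (runScan lo hi s (u ++ p₁ ∷ p₂ ∷ v))
    ≡⟨ cong proj₂ (foldl-++ (stepAt lo hi) s u (p₁ ∷ p₂ ∷ v)) ⟩
  proj₂ (runScan lo hi (twoSteps (runScan lo hi s u)) v)
    ≡⟨ runScan-summary lo hi d _ v ⟩
  resume (summary lo hi d v) (twoSteps (runScan lo hi s u))
    ≡⟨ cong₂ (λ t s' → resume t (twoSteps s')) (summary-cong d agreeᵥ) (runScan-cong s agreeᵤ) ⟩
  resume (summary lo' hi' d v) (twoSteps (runScan lo' hi' s u)) ∎
  where
  open ≡-Reasoning
  twoSteps : ScanState ℕ → ScanState ℕ
  twoSteps s' = stepAt lo hi (stepAt lo hi s' p₁) p₂

interval : ℕ → ℕ → List ℕ
interval a zero    = []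
interval a (suc n) = suc a ∷ interval (suc a) n

range≡interval : ∀ n → range n ≡ interval 0 n
range≡interval n = shifted (λ i → i) 0 n (λ _ → refl)
  where
  shifted : ∀ (f : ℕ → ℕ) a n → (∀ i → f i ≡ a + i) → List.map suc (applyUpTo f n) ≡ interval a n
  shifted f a zero    f≡ = refl
  shifted f a (suc n) f≡ =
    cong₂ _∷_ (cong suc (trans (f≡ 0) (+-identityʳ a)))
              (shifted (f ∘ suc) (suc a) n (λ i → trans (f≡ (suc i)) (+-suc a i)))

interval-++ : ∀ a m n → interval a (m + n) ≡ interval a m ++ interval (a + m) n
interval-++ a zero    n rewrite +-identityʳ a = refl
interval-++ a (suc m) n rewrite interval-++ (suc a) m n | +-suc a m = refl

interval-bounds : ∀ a n → All (λ p → a < p × p ≤ a + n) (interval a n)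
interval-bounds a zero    = []
interval-bounds a (suc n) rewrite +-suc a n =
  (≤-refl , s≤s (m≤m+n a n)) ∷ All.map (λ (a<p , p≤) → <-trans (n<1+n a) a<p , p≤) (interval-bounds (suc a) n)

interval-extend : ∀ {b N} → b ≤ N → interval 0 N ≡ interval 0 b ++ interval b (N ∸ b)
interval-extend {b} {N} b≤N = trans (cong (interval 0) (sym (m+[n∸m]≡n b≤N))) (interval-++ 0 b (N ∸ b))

interval-upto : ∀ {a N} → a ≤ N → All (λ p → a < p × p ≤ N) (interval a (N ∸ a))
interval-upto {a} {N} a≤N =
  All.map (λ (a<p , p≤) → a<p , subst (_ ≤_) (m+[n∸m]≡n a≤N) p≤) (interval-bounds a (N ∸ a))

interval-split : ∀ p₀ {N} → suc (suc p₀) ≤ N →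
  interval 0 N ≡ interval 0 p₀ ++ suc p₀ ∷ suc (suc p₀) ∷ interval (suc (suc p₀)) (N ∸ suc (suc p₀))
interval-split p₀ {N} le = trans (cong (interval 0) N≡) (interval-++ 0 p₀ (suc (suc t)))
  where
  t = N ∸ suc (suc p₀)
  N≡ : N ≡ p₀ + suc (suc t)
  N≡ = trans (sym (m+[n∸m]≡n le)) (sym (trans (+-suc p₀ (suc t)) (cong suc (+-suc p₀ t))))

reverse-window : ∀ (u : List ℕ) x y v → reverse (u ++ x ∷ y ∷ v) ≡ reverse v ++ y ∷ x ∷ reverse u
reverse-window u x y v rewrite reverse-++ u (x ∷ y ∷ v) | reverse-++ (x ∷ y ∷ []) v
  | ++-assoc (reverse v) (y ∷ x ∷ []) (reverse u) = refl

All-reverse : ∀ {P : ℕ → Set} {xs} → All P xs → All P (reverse xs)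
All-reverse Pxs = All.tabulate (λ p∈ → All.lookup Pxs (Any.reverse⁻ p∈))

scan-padded : ∀ lo hi {b N} → b ≤ N → (∀ p → b < p → Silent lo hi p) →
  scan lo hi 0 nothing (range b) ≡ proj₂ (runScan lo hi (0 , nothing) (interval 0 N))
scan-padded lo hi {b} {N} b≤N silent = begin
  scan lo hi 0 nothing (range b)
    ≡⟨ scan≡runScan lo hi 0 nothing (range b) ⟩
  proj₂ (runScan lo hi (0 , nothing) (range b))
    ≡⟨ cong (proj₂ ∘ runScan lo hi _) (range≡interval b) ⟩
  proj₂ (runScan lo hi (0 , nothing) (interval 0 b))
    ≡⟨ cong proj₂ (sym (runScan-silent _ beyond)) ⟩
  proj₂ (runScan lo hi (runScan lo hi (0 , nothing) (interval 0 b)) (interval b (N ∸ b)))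
    ≡⟨ cong proj₂ (sym (foldl-++ (stepAt lo hi) _ (interval 0 b) _)) ⟩
  proj₂ (runScan lo hi (0 , nothing) (interval 0 b ++ interval b (N ∸ b)))
    ≡⟨ cong (proj₂ ∘ runScan lo hi _) (sym (interval-extend b≤N)) ⟩
  proj₂ (runScan lo hi (0 , nothing) (interval 0 N)) ∎
  where
  open ≡-Reasoning
  beyond = All.map (λ (b<p , _) → silent _ b<p) (interval-upto b≤N)

scan-padded-reverse : ∀ lo hi {b N} → b ≤ N → (∀ p → b < p → Silent lo hi p) →
  scan lo hi 0 nothing (reverse (range b)) ≡ proj₂ (runScan lo hi (0 , nothing) (reverse (interval 0 N)))
scan-padded-reverse lo hi {b} {N} b≤N silent = begin
  scan lo hi 0 nothing (reverse (range b))
    ≡⟨ scan≡runScan lo hi 0 nothing (reverse (range b)) ⟩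
  proj₂ (runScan lo hi (0 , nothing) (reverse (range b)))
    ≡⟨ cong (proj₂ ∘ runScan lo hi _ ∘ reverse) (range≡interval b) ⟩
  proj₂ (runScan lo hi (0 , nothing) (reverse (interval 0 b)))
    ≡⟨ cong (λ s → proj₂ (runScan lo hi s (reverse (interval 0 b)))) (sym (runScan-silent _ beyond)) ⟩
  proj₂ (runScan lo hi (runScan lo hi (0 , nothing) (reverse (interval b (N ∸ b)))) (reverse (interval 0 b)))
    ≡⟨ cong proj₂ (sym (foldl-++ (stepAt lo hi) _ (reverse (interval b (N ∸ b))) _)) ⟩
  proj₂ (runScan lo hi (0 , nothing) (reverse (interval b (N ∸ b)) ++ reverse (interval 0 b)))
    ≡⟨ cong (proj₂ ∘ runScan lo hi _) (sym (reverse-++ (interval 0 b) _)) ⟩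
  proj₂ (runScan lo hi (0 , nothing) (reverse (interval 0 b ++ interval b (N ∸ b))))
    ≡⟨ cong (proj₂ ∘ runScan lo hi _ ∘ reverse) (sym (interval-extend b≤N)) ⟩
  proj₂ (runScan lo hi (0 , nothing) (reverse (interval 0 N))) ∎
  where
  open ≡-Reasoning
  beyond = All-reverse (All.map (λ (b<p , _) → silent _ b<p) (interval-upto b≤N))

BoundedBy : ℕ → Diagram → Set
BoundedBy n D = ∀ z → mem D z ≡ true → proj₁ z ≤ n × proj₂ z ≤ n

bounded-bound : ∀ D → BoundedBy (bound D) D
bounded-bound (d@(a , b) ∷ D) z z∈ rewrite mem-∷ d D z with d ≟C z in d≟z
... | true rewrite sym (≟C⇒≡ {d} {z} d≟z) =
  ≤-trans (m≤m⊔n a b) (m≤m⊔n (a ⊔ b) (bound D)) , ≤-trans (m≤n⊔m a b) (m≤m⊔n (a ⊔ b) (bound D))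
... | false with bounded-bound D z z∈
...   | a≤ , b≤ = ≤-trans a≤ (m≤n⊔m (a ⊔ b) (bound D)) , ≤-trans b≤ (m≤n⊔m (a ⊔ b) (bound D))

bound-least : ∀ {n} D → BoundedBy n D → bound D ≤ n
bound-least [] _ = z≤n
bound-least {n} (d@(a , b) ∷ D) bounded with bounded d (∈⇒mem (d ∷ D) d (here refl))
... | a≤n , b≤n = ⊔-lub (⊔-lub a≤n b≤n) (bound-least D (λ z z∈ → bounded z (mem-∷-tail z z∈)))
  where
  mem-∷-tail : ∀ z → mem D z ≡ true → mem (d ∷ D) z ≡ true
  mem-∷-tail z z∈ rewrite mem-∷ d D z | z∈ with d ≟C z
  ... | true  = refl
  ... | false = refl

BoundedBy-mono : ∀ {m n} D → m ≤ n → BoundedBy m D → BoundedBy n D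
BoundedBy-mono D m≤n bounded z z∈ with bounded z z∈
... | a≤ , b≤ = ≤-trans a≤ m≤n , ≤-trans b≤ m≤n

BoundedBy-moveCell : ∀ {n} x y D → BoundedBy n D → proj₁ y ≤ n → proj₂ y ≤ n →
  BoundedBy n (moveCell x y D)
BoundedBy-moveCell x y D bounded y₁≤ y₂≤ z z∈ rewrite mem-moveCell x y D z with z ≟C y in z≟y
... | true rewrite ≟C⇒≡ {z} {y} z≟y = y₁≤ , y₂≤
... | false with mem D z in z∈D
...   | true = bounded z z∈D

mem-beyond-col : ∀ {n} D i {p} → BoundedBy n D → n < p → mem D (i , p) ≡ false
mem-beyond-col D i {p} bounded n<p with mem D (i , p) in z∈
... | true  = contradiction (proj₂ (bounded _ z∈)) (<⇒≱ n<p)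
... | false = refl

mem-beyond-row : ∀ {n} D i {p} → BoundedBy n D → n < p → mem D (p , i) ≡ false
mem-beyond-row D i {p} bounded n<p with mem D (p , i) in z∈
... | true  = contradiction (proj₁ (bounded _ z∈)) (<⇒≱ n<p)
... | false = refl

-- Abstracting a scan around two positions

record Window : Set where
  constructor window
  field
    opens     : ℕ
    threshold : ℕ
    pending   : Bool

windowResult : {A : Set} → Window → (aL a₁ a₂ top : A) → (x₁ y₁ x₂ y₂ : Bool) → Maybe A
windowResult (window k m pend) aL a₁ a₂ top x₁ y₁ x₂ y₂ =
  resume (m , top) (scanStep x₂ y₂ a₂ (scanStep x₁ y₁ a₁ (k , (if pend then just aL else nothing))))

-- Two steps change the open count k by at most 2, so all that matters is whether it
-- reaches 0 and how it finally compares with the threshold m: a count above 2 is traded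
-- for the offset k ∸ 2 on the threshold, which can then be capped at 5.
abstractWindow : ScanState ℕ → ℕ → Window
abstractWindow (k , l) m = window (2 ⊓ k) (5 ⊓ (m ∸ (k ∸ 2))) (is-just l)

Simulates : {A : Set} → (A → ℕ) → ℕ → ScanState ℕ → ScanState A → Set
Simulates f base (k , l) (b , la) = k ≡ b + base × l ≡ Maybe.map f la

scanStep-simulates : ∀ {A} (f : A → ℕ) base x y a {s sa} → Simulates f base s sa →
  base ≡ 0 ⊎ 1 ≤ proj₁ sa → Simulates f base (scanStep x y (f a) s) (scanStep x y a sa)
scanStep-simulates f base true  true  a sim _ = sim
scanStep-simulates f base false false a sim _ = sim
scanStep-simulates f base true  false a (refl , l≡) _ = refl , l≡
scanStep-simulates f .0 false true a {_ , _} {zero , _} (refl , _) (inj₁ refl) = refl , refl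
scanStep-simulates f base false true a {_ , _} {suc b , _} (refl , l≡) _ = refl , l≡

scanStep-count≤ : ∀ {A} x y (a : A) s → proj₁ (scanStep x y a s) ≤ suc (proj₁ s)
scanStep-count≤ true  true  a (k , l)     = n≤1+n k
scanStep-count≤ false false a (k , l)     = n≤1+n k
scanStep-count≤ true  false a (k , l)     = ≤-refl
scanStep-count≤ false true  a (zero , l)  = z≤n
scanStep-count≤ false true  a (suc k , l) = ≤-trans (n≤1+n k) (n≤1+n (suc k))

scanStep-count≥ : ∀ {A} x y (a : A) s → pred (proj₁ s) ≤ proj₁ (scanStep x y a s)
scanStep-count≥ true  true  a (k , l)     = pred[n]≤n
scanStep-count≥ false false a (k , l)     = scanStep-count≥ true true a (k , l)
scanStep-count≥ true  false a (k , l)     = ≤-trans (scanStep-count≥ true true a (k , l)) (n≤1+n k)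
scanStep-count≥ false true  a (zero , l)  = z≤n
scanStep-count≥ false true  a (suc k , l) = ≤-refl

<ᵇ-offset : ∀ b base m → ((b + base) <ᵇ m) ≡ (b <ᵇ (m ∸ base))
<ᵇ-offset b zero    m       rewrite +-identityʳ b = refl
<ᵇ-offset b (suc base) zero with b
... | zero  = refl
... | suc _ = refl
<ᵇ-offset b (suc base) (suc m) rewrite +-suc b base = <ᵇ-offset b base m

<ᵇ-cap : ∀ b n m → b < n → (b <ᵇ m) ≡ (b <ᵇ (n ⊓ m))
<ᵇ-cap zero    (suc n) zero    _ = refl
<ᵇ-cap zero    (suc n) (suc m) _ = refl
<ᵇ-cap (suc b) (suc n) zero    _ = refl
<ᵇ-cap (suc b) (suc n) (suc m) (s≤s b<n) = <ᵇ-cap b n m b<n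

resume-simulates : ∀ {A} (f : A → ℕ) base m top {s sa} → Simulates f base s sa → proj₁ sa < 5 →
  resume (m , f top) s ≡ Maybe.map f (resume (5 ⊓ (m ∸ base) , top) sa)
resume-simulates f base m top {_ , _} {b , la} (refl , refl) b<5
  rewrite <ᵇ-offset b base m | <ᵇ-cap b 5 (m ∸ base) b<5 with b <ᵇ (5 ⊓ (m ∸ base))
... | true  = refl
... | false = refl

window-abstraction : ∀ {A} (f : A → ℕ) (aL a₁ a₂ top : A) x₁ y₁ x₂ y₂ m {k l} →
  l ≡ Maybe.map f (if is-just l then just aL else nothing) →
  resume (m , f top) (scanStep x₂ y₂ (f a₂) (scanStep x₁ y₁ (f a₁) (k , l)))
    ≡ Maybe.map f (windowResult (abstractWindow (k , l) m) aL a₁ a₂ top x₁ y₁ x₂ y₂)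
window-abstraction f aL a₁ a₂ top x₁ y₁ x₂ y₂ m {k} {l} l≡ = byCount k
  where
  la = if is-just l then just aL else nothing
  twoSteps₀ : ∀ {s sa} → Simulates f 0 s sa →
    Simulates f 0 (scanStep x₂ y₂ (f a₂) (scanStep x₁ y₁ (f a₁) s)) (scanStep x₂ y₂ a₂ (scanStep x₁ y₁ a₁ sa))
  twoSteps₀ sim = scanStep-simulates f 0 x₂ y₂ a₂ (scanStep-simulates f 0 x₁ y₁ a₁ sim (inj₁ refl)) (inj₁ refl)
  small : ∀ b → b ≤ 2 → proj₁ (scanStep x₂ y₂ a₂ (scanStep x₁ y₁ a₁ (b , la))) < 5
  small b b≤2 = s≤s (≤-trans (scanStep-count≤ x₂ y₂ a₂ _)
                     (s≤s (≤-trans (scanStep-count≤ x₁ y₁ a₁ _) (s≤s b≤2))))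
  byCount : ∀ k → resume (m , f top) (scanStep x₂ y₂ (f a₂) (scanStep x₁ y₁ (f a₁) (k , l)))
               ≡ Maybe.map f (windowResult (abstractWindow (k , l) m) aL a₁ a₂ top x₁ y₁ x₂ y₂)
  byCount zero = resume-simulates f 0 m top (twoSteps₀ (refl , l≡)) (small 0 z≤n)
  byCount (suc zero) = resume-simulates f 0 m top (twoSteps₀ (refl , l≡)) (small 1 (s≤s z≤n))
  byCount (suc (suc k)) =
    resume-simulates f k m top
      (scanStep-simulates f k x₂ y₂ a₂ (scanStep-simulates f k x₁ y₁ a₁ (refl , l≡) (inj₂ (s≤s z≤n)))
        (inj₂ (scanStep-count≥ x₁ y₁ a₁ (2 , la))))
      (small 2 ≤-refl)

pending-position : ∀ {A : Set} (f : A → ℕ) a d l → f a ≡ fromMaybe d l →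
  l ≡ Maybe.map f (if is-just l then just a else nothing)
pending-position f a d nothing  _    = refl
pending-position f a d (just x) fa≡x = cong just (sym fa≡x)

data Side : Set where
  lo hi : Side

-- Along an axis, at lo and at hi are the rows r, r+1 (columns c, c+1), while before and
-- after each stand for the single position on that side that a scan of D may report.
data Zone : Set where
  before : Zone
  at     : Side → Zone
  after  : Zone

_==ᶻ_ : Zone → Zone → Bool
before ==ᶻ before = true
at lo  ==ᶻ at lo  = true
at hi  ==ᶻ at hi  = true
after  ==ᶻ after  = true
_      ==ᶻ _      = false

-- nothing classifies a coordinate that is none of the four positions of its axis.
_is_ : Maybe Zone → Zone → Bool
nothing is _ = false
just a  is b = a ==ᶻ b

==ᶻ-refl : ∀ a → a ==ᶻ a ≡ true
==ᶻ-refl before = refl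
==ᶻ-refl (at lo) = refl
==ᶻ-refl (at hi) = refl
==ᶻ-refl after  = refl

Increasing : (Zone → ℕ) → Set
Increasing pos = pos before < pos (at lo) × pos (at lo) < pos (at hi) × pos (at hi) < pos after

record ZoneOf (pos : Zone → ℕ) (n : ℕ) (σ : Maybe Zone) : Set where
  constructor zoneOf
  field
    zone-test : ∀ a → does (n ≟ pos a) ≡ σ is a

open ZoneOf

zoneOf-≡ : ∀ {pos n a} → ZoneOf pos n (just a) → n ≡ pos a
zoneOf-≡ {pos} {n} {a} zone = does-sound (n ≟ pos a) (trans (zone-test zone a) (==ᶻ-refl a))

module _ {pos : Zone → ℕ} (increasing : Increasing pos) where

  private
    b<l = proj₁ increasing
    l<h = proj₁ (proj₂ increasing)
    h<a = proj₂ (proj₂ increasing)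

    same : ∀ a → does (pos a ≟ pos a) ≡ true
    same a = dec-true (pos a ≟ pos a) refl

    differ : ∀ a b → pos a ≢ pos b → does (pos a ≟ pos b) ≡ false
    differ a b = dec-false (pos a ≟ pos b)

  zoneOf-pos : ∀ a → ZoneOf pos (pos a) (just a)
  zoneOf-pos a = zoneOf (test a)
    where
    test : ∀ a b → does (pos a ≟ pos b) ≡ a ==ᶻ b
    test before  before  = same before
    test before  (at lo) = differ before (at lo) (<⇒≢ b<l)
    test before  (at hi) = differ before (at hi) (<⇒≢ (<-trans b<l l<h))
    test before  after   = differ before after (<⇒≢ (<-trans (<-trans b<l l<h) h<a))
    test (at lo) before  = differ (at lo) before (>⇒≢ b<l)
    test (at lo) (at lo) = same (at lo)
    test (at lo) (at hi) = differ (at lo) (at hi) (<⇒≢ l<h)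
    test (at lo) after   = differ (at lo) after (<⇒≢ (<-trans l<h h<a))
    test (at hi) before  = differ (at hi) before (>⇒≢ (<-trans b<l l<h))
    test (at hi) (at lo) = differ (at hi) (at lo) (>⇒≢ l<h)
    test (at hi) (at hi) = same (at hi)
    test (at hi) after   = differ (at hi) after (<⇒≢ h<a)
    test after   before  = differ after before (>⇒≢ (<-trans (<-trans b<l l<h) h<a))
    test after   (at lo) = differ after (at lo) (>⇒≢ (<-trans l<h h<a))
    test after   (at hi) = differ after (at hi) (>⇒≢ h<a)
    test after   after   = same after

  classify : ∀ n → Σ (Maybe Zone) (ZoneOf pos n)
  classify n with n ≟ pos before | n ≟ pos (at lo) | n ≟ pos (at hi) | n ≟ pos after
  ... | yes refl | _        | _        | _        = just before  , zoneOf-pos before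
  ... | no _     | yes refl | _        | _        = just (at lo) , zoneOf-pos (at lo)
  ... | no _     | no _     | yes refl | _        = just (at hi) , zoneOf-pos (at hi)
  ... | no _     | no _     | no _     | yes refl = just after    , zoneOf-pos after
  ... | no n≢b   | no n≢l   | no n≢h   | no n≢a   = nothing , zoneOf λ where
    before  → dec-false (n ≟ pos before) n≢b
    (at lo) → dec-false (n ≟ pos (at lo)) n≢l
    (at hi) → dec-false (n ≟ pos (at hi)) n≢h
    after   → dec-false (n ≟ pos after) n≢a

Loc : Set
Loc = Zone × Zone

Move : Set
Move = Loc × Loc

raise : Zone → Move
raise s = (at hi , s) , (at lo , s)

rectify : Zone → Move
rectify t = (t , at hi) , (t , at lo)

cellIs : Maybe Zone → Maybe Zone → Loc → Bool
cellIs σ τ (a , b) = σ is a ∧ τ is b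

moved : Maybe Zone → Maybe Zone → Move → Bool → Bool
moved σ τ (x , y) β = cellIs σ τ y ∨ (β ∧ not (cellIs σ τ x))

record Block : Set where
  constructor block
  field
    lolo lohi hilo hihi : Bool

bit : Block → Side → Side → Bool
bit bs lo lo = Block.lolo bs
bit bs lo hi = Block.lohi bs
bit bs hi lo = Block.hilo bs
bit bs hi hi = Block.hihi bs

afterMove : Move → Block → Block
afterMove mv bs = block (cell lo lo) (cell lo hi) (cell hi lo) (cell hi hi)
  where
  cell : Side → Side → Bool
  cell i j = moved (just (at i)) (just (at j)) mv (bit bs i j)

verticalScan : Window → Block → Maybe Zone
verticalScan w bs =
  windowResult w before (at lo) (at hi) after (bit bs lo lo) (bit bs hi lo) (bit bs lo hi) (bit bs hi hi)

horizontalScan : Window → Block → Maybe Zone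
horizontalScan w bs =
  windowResult w after (at hi) (at lo) before (bit bs hi lo) (bit bs hi hi) (bit bs lo lo) (bit bs lo hi)

_==_ : Bool → Bool → Bool
true  == y = y
false == y = not y

==-sound : ∀ {x y} → (x == y) ≡ true → x ≡ y
==-sound {true}  {true}  _ = refl
==-sound {false} {false} _ = refl

==-refl : ∀ x → (x == x) ≡ true
==-refl true  = refl
==-refl false = refl

-- Outside the 2 × 2 block the membership β of a cell of D is arbitrary.
fits : Block → Maybe Zone → Maybe Zone → Bool → Bool
fits bs (just (at i)) (just (at j)) β = β == bit bs i j
fits bs _             _             β = true

-- Exhaustive checks

allBool : (Bool → Bool) → Bool
allBool f = f true ∧ f false

allBool-sound : ∀ f → allBool f ≡ true → ∀ b → f b ≡ true
allBool-sound f ok true  = proj₁ (∧-split (f true) ok)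
allBool-sound f ok false = proj₂ (∧-split (f true) ok)

allMaybeZone : (Maybe Zone → Bool) → Bool
allMaybeZone f = f nothing ∧ f (just before) ∧ f (just (at lo)) ∧ f (just (at hi)) ∧ f (just after)

allMaybeZone-sound : ∀ f → allMaybeZone f ≡ true → ∀ σ → f σ ≡ true
allMaybeZone-sound f ok σ with ∧-split (f nothing) ok
... | ok₀ , ok₁₂₃₄ with ∧-split (f (just before)) ok₁₂₃₄
...   | ok₁ , ok₂₃₄ with ∧-split (f (just (at lo))) ok₂₃₄
...     | ok₂ , ok₃₄ with ∧-split (f (just (at hi))) ok₃₄
...       | ok₃ , ok₄ with σ
...         | nothing       = ok₀
...         | just before   = ok₁
...         | just (at lo)  = ok₂
...         | just (at hi)  = ok₃
...         | just after    = ok₄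

allUpTo : ℕ → (ℕ → Bool) → Bool
allUpTo zero    f = f zero
allUpTo (suc n) f = f zero ∧ allUpTo n (f ∘ suc)

allUpTo-sound : ∀ n f → allUpTo n f ≡ true → ∀ {k} → k ≤ n → f k ≡ true
allUpTo-sound zero    f ok z≤n = ok
allUpTo-sound (suc n) f ok z≤n = proj₁ (∧-split (f zero) ok)
allUpTo-sound (suc n) f ok (s≤s k≤n) = allUpTo-sound n (f ∘ suc) (proj₂ (∧-split (f zero) ok)) k≤n

allBlock : (Block → Bool) → Bool
allBlock f = allBool λ a → allBool λ b → allBool λ c → allBool λ d → f (block a b c d)

allBlock-sound : ∀ f → allBlock f ≡ true → ∀ bs → f bs ≡ true
allBlock-sound f ok (block a b c d) =
  allBool-sound (λ d → f (block a b c d))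
    (allBool-sound (λ c → allBool λ d → f (block a b c d))
      (allBool-sound (λ b → allBool λ c → allBool λ d → f (block a b c d))
        (allBool-sound (λ a → allBool λ b → allBool λ c → allBool λ d → f (block a b c d)) ok a) b) c) d

allWindow : (Window → Bool) → Bool
allWindow f = allUpTo 2 λ k → allUpTo 5 λ m → allBool λ pend → f (window k m pend)

allWindow-sound : ∀ f → allWindow f ≡ true → ∀ s m → f (abstractWindow s m) ≡ true
allWindow-sound f ok (k , l) m =
  allBool-sound (λ pend → f (window (2 ⊓ k) (5 ⊓ (m ∸ (k ∸ 2))) pend))
    (allUpTo-sound 5 (λ t → allBool λ pend → f (window (2 ⊓ k) t pend))
      (allUpTo-sound 2 (λ k → allUpTo 5 λ t → allBool λ pend → f (window k t pend)) ok (m⊓n≤m 2 k))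
      (m⊓n≤m 5 _))
    (is-just l)

-- Commutation in the finite model

raiseAfterRectify? : (Block → Maybe Zone) → Block → Maybe Zone → Maybe Zone → Bool
raiseAfterRectify? v bs a nothing  = true
raiseAfterRectify? v bs a (just t) = is-just a == is-just (v (afterMove (rectify t) bs))

rectifyAfterRaise? : (Block → Maybe Zone) → Block → Maybe Zone → Maybe Zone → Bool
rectifyAfterRaise? h bs nothing  b = true
rectifyAfterRaise? h bs (just s) b = is-just b == is-just (h (afterMove (raise s) bs))

cellCommutes? : Block → (s t s' t' : Zone) → Maybe Zone → Maybe Zone → Bool → Bool
cellCommutes? bs s t s' t' σ τ β = not (fits bs σ τ β) ∨
  (moved σ τ (rectify t') (moved σ τ (raise s) β) == moved σ τ (raise s') (moved σ τ (rectify t) β))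

cellsCommute? : Block → (s t s' t' : Zone) → Bool
cellsCommute? bs s t s' t' = allMaybeZone λ σ → allMaybeZone λ τ → allBool (cellCommutes? bs s t s' t' σ τ)

cellsCommute-sound : ∀ {bs s t s' t'} → cellsCommute? bs s t s' t' ≡ true →
  ∀ σ τ β → fits bs σ τ β ≡ true →
  moved σ τ (rectify t') (moved σ τ (raise s) β) ≡ moved σ τ (raise s') (moved σ τ (rectify t) β)
cellsCommute-sound {bs} {s} {t} {s'} {t'} ok σ τ β fit =
  ==-sound (implies (fits bs σ τ β) fit (allBool-sound (check σ τ) (allMaybeZone-sound (allBool ∘ check σ)
    (allMaybeZone-sound (λ σ → allMaybeZone λ τ → allBool (check σ τ)) ok σ) τ) β))
  where
  check = cellCommutes? bs s t s' t'
  implies : ∀ x {y} → x ≡ true → not x ∨ y ≡ true → y ≡ true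
  implies true _ y = y

squareAfter? : Block → Zone → Zone → Maybe Zone → Maybe Zone → Bool
squareAfter? bs s t (just s') (just t') = cellsCommute? bs s t s' t'
squareAfter? bs s t _         _         = false

square? : (v h : Block → Maybe Zone) → Block → Maybe Zone → Maybe Zone → Bool
square? v h bs (just s) (just t) =
  squareAfter? bs s t (v (afterMove (rectify t) bs)) (h (afterMove (raise s) bs))
square? v h bs _        _        = true

commutesAt : Window → Window → Block → Bool
commutesAt w w' bs =
  raiseAfterRectify? v bs (v bs) (h bs) ∧ rectifyAfterRaise? h bs (v bs) (h bs) ∧ square? v h bs (v bs) (h bs)
  where
  v h : Block → Maybe Zone
  v = verticalScan w
  h = horizontalScan w'

commutes-everywhere : (allWindow λ w → allWindow λ w' → allBlock (commutesAt w w')) ≡ true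
commutes-everywhere = refl

commutes : ∀ s m s' m' bs → commutesAt (abstractWindow s m) (abstractWindow s' m') bs ≡ true
commutes s m s' m' =
  allBlock-sound (commutesAt w (abstractWindow s' m'))
    (allWindow-sound (λ w' → allBlock (commutesAt w w'))
      (allWindow-sound (λ w → allWindow λ w' → allBlock (commutesAt w w')) commutes-everywhere s m) s' m')
  where
  w = abstractWindow s m

nonZero-map-⇔ : ∀ {A B : Set} (f : A → Diagram) (g : B → Diagram) a b → is-just a ≡ is-just b →
  NonZero (Maybe.map f a) ⇔ NonZero (Maybe.map g b)
nonZero-map-⇔ f g nothing  nothing  _ = mk⇔ id id
nonZero-map-⇔ f g (just _) (just _) _ = mk⇔ id id

module Crossing (D : Diagram) (r₀ c₀ : ℕ) where

  r c N : ℕ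
  r = suc r₀
  c = suc c₀
  N = suc (suc (bound D + c + r))

  bound≤N : bound D ≤ N
  bound≤N = ≤-trans (≤-trans (m≤m+n (bound D) c) (m≤m+n _ r)) (≤-trans (n≤1+n _) (n≤1+n _))

  c+2≤N : suc (suc c) ≤ N
  c+2≤N = s≤s (s≤s (≤-trans (m≤n+m c (bound D)) (m≤m+n _ r)))

  r+2≤N : suc (suc r) ≤ N
  r+2≤N = s≤s (s≤s (m≤n+m r (bound D + c)))

  c+1≤N : suc c ≤ N
  c+1≤N = ≤-trans (n≤1+n _) c+2≤N

  r+1≤N : suc r ≤ N
  r+1≤N = ≤-trans (n≤1+n _) r+2≤N

  vLo vHi hLo hHi : Diagram → ℕ → Bool
  vLo D' p = mem D' (r , p)
  vHi D' p = mem D' (suc r , p)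
  hLo D' p = mem D' (p , c)
  hHi D' p = mem D' (p , suc c)

  leftCols rightCols upperRows lowerRows : List ℕ
  leftCols  = interval 0 c₀
  rightCols = interval (suc c) (N ∸ suc c)
  upperRows = reverse (interval (suc r) (N ∸ suc r))
  lowerRows = reverse (interval 0 r₀)

  columns : interval 0 N ≡ leftCols ++ c ∷ suc c ∷ rightCols
  columns = interval-split c₀ c+1≤N

  rows : reverse (interval 0 N) ≡ upperRows ++ suc r ∷ r ∷ lowerRows
  rows = trans (cong reverse (interval-split r₀ r+1≤N)) (reverse-window (interval 0 r₀) r (suc r) _)

  start : ScanState ℕ
  start = 0 , nothing

  vPrefix hPrefix : ScanState ℕ
  vPrefix = runScan (vLo D) (vHi D) start leftCols
  hPrefix = runScan (hLo D) (hHi D) start upperRows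

  vSuffix hSuffix : ℕ × ℕ
  vSuffix = summary (vLo D) (vHi D) (suc (suc c)) rightCols
  hSuffix = summary (hLo D) (hHi D) 0 lowerRows

  -- A zone whose scan reports nothing gets a default position, chosen only to keep
  -- the positions increasing.
  colAt rowAt : Zone → ℕ
  colAt before  = fromMaybe 0 (proj₂ vPrefix)
  colAt (at lo) = c
  colAt (at hi) = suc c
  colAt after   = proj₂ vSuffix
  rowAt before  = proj₂ hSuffix
  rowAt (at lo) = r
  rowAt (at hi) = suc r
  rowAt after   = fromMaybe (suc (suc r)) (proj₂ hPrefix)

  vScan hScan : Block → Maybe Zone
  vScan = verticalScan (abstractWindow vPrefix (proj₁ vSuffix))
  hScan = horizontalScan (abstractWindow hPrefix (proj₁ hSuffix))

  leftCols-bounds : All (λ p → p < c) leftCols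
  leftCols-bounds = All.map (λ (_ , p≤c₀) → s≤s p≤c₀) (interval-bounds 0 c₀)

  rightCols-bounds : All (λ p → suc c < p × p ≤ N) rightCols
  rightCols-bounds = interval-upto c+1≤N

  upperRows-bounds : All (λ p → suc r < p × p ≤ N) upperRows
  upperRows-bounds = All-reverse (interval-upto r+1≤N)

  lowerRows-bounds : All (λ p → p < r) lowerRows
  lowerRows-bounds = All-reverse (All.map (λ (_ , p≤r₀) → s≤s p≤r₀) (interval-bounds 0 r₀))

  colAt-before : colAt before < c
  colAt-before = fromMaybe-All (runScan-All start leftCols-bounds MaybeAll.nothing) (s≤s z≤n)

  colAt-after : suc c < colAt after × colAt after ≤ N
  colAt-after = summary-All (vLo D) (vHi D) (suc (suc c)) rightCols-bounds (≤-refl , c+2≤N)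

  rowAt-before : rowAt before < r
  rowAt-before = summary-All (hLo D) (hHi D) 0 lowerRows-bounds (s≤s z≤n)

  rowAt-after : suc r < rowAt after × rowAt after ≤ N
  rowAt-after = fromMaybe-All (runScan-All start upperRows-bounds MaybeAll.nothing) (≤-refl , r+2≤N)

  col-increasing : Increasing colAt
  col-increasing = colAt-before , n<1+n c , proj₁ colAt-after

  row-increasing : Increasing rowAt
  row-increasing = rowAt-before , n<1+n r , proj₁ rowAt-after

  colAt≤N : ∀ a → colAt a ≤ N
  colAt≤N before  = ≤-trans (<⇒≤ colAt-before) (≤-trans (n≤1+n c) c+1≤N)
  colAt≤N (at lo) = ≤-trans (n≤1+n c) c+1≤N
  colAt≤N (at hi) = c+1≤N
  colAt≤N after   = proj₂ colAt-after

  rowAt≤N : ∀ a → rowAt a ≤ N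
  rowAt≤N before  = ≤-trans (<⇒≤ rowAt-before) (≤-trans (n≤1+n r) r+1≤N)
  rowAt≤N (at lo) = ≤-trans (n≤1+n r) r+1≤N
  rowAt≤N (at hi) = r+1≤N
  rowAt≤N after   = proj₂ rowAt-after

  row-zone : ∀ a → ZoneOf rowAt (rowAt a) (just a)
  row-zone = zoneOf-pos {rowAt} row-increasing

  col-zone : ∀ a → ZoneOf colAt (colAt a) (just a)
  col-zone = zoneOf-pos {colAt} col-increasing

  bitsOf : Diagram → Block
  bitsOf D' = block (mem D' (r , c)) (mem D' (r , suc c)) (mem D' (suc r , c)) (mem D' (suc r , suc c))

  bit-bitsOf : ∀ D' i j → bit (bitsOf D') i j ≡ mem D' (rowAt (at i) , colAt (at j))
  bit-bitsOf D' lo lo = refl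
  bit-bitsOf D' lo hi = refl
  bit-bitsOf D' hi lo = refl
  bit-bitsOf D' hi hi = refl

  VAgree HAgree : Diagram → Set
  VAgree D' = ∀ {p} → p ≢ c → p ≢ suc c → Agree (vLo D') (vHi D') (vLo D) (vHi D) p
  HAgree D' = ∀ {p} → p ≢ r → p ≢ suc r → Agree (hLo D') (hHi D') (hLo D) (hHi D) p

  vertical-scan : ∀ D' → BoundedBy N D' → VAgree D' →
    rightmostUnpairedV r D' ≡ Maybe.map colAt (vScan (bitsOf D'))
  vertical-scan D' bounded agree = begin
    rightmostUnpairedV r D'
      ≡⟨ scan-padded (vLo D') (vHi D') (bound-least D' bounded) (λ p b<p → beyond b<p , beyond b<p) ⟩
    proj₂ (runScan (vLo D') (vHi D') start (interval 0 N))
      ≡⟨ cong (proj₂ ∘ runScan (vLo D') (vHi D') start) columns ⟩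
    proj₂ (runScan (vLo D') (vHi D') start (leftCols ++ c ∷ suc c ∷ rightCols))
      ≡⟨ runScan-window start leftCols c (suc c) rightCols (suc (suc c))
           (All.map (λ p<c → agree (<⇒≢ p<c) (<⇒≢ (≤-trans p<c (n≤1+n c)))) leftCols-bounds)
           (All.map (λ (c+1<p , _) → agree (>⇒≢ (<-trans (n<1+n c) c+1<p)) (>⇒≢ c+1<p)) rightCols-bounds) ⟩
    resume vSuffix (stepAt (vLo D') (vHi D') (stepAt (vLo D') (vHi D') vPrefix c) (suc c))
      ≡⟨ window-abstraction colAt before (at lo) (at hi) after
           (vLo D' c) (vHi D' c) (vLo D' (suc c)) (vHi D' (suc c)) (proj₁ vSuffix)
           (pending-position colAt before 0 (proj₂ vPrefix) refl) ⟩
    Maybe.map colAt (vScan (bitsOf D')) ∎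
    where
    open ≡-Reasoning
    beyond : ∀ {i p} → bound D' < p → mem D' (i , p) ≡ false
    beyond {i} = mem-beyond-col D' i (bounded-bound D')

  horizontal-scan : ∀ D' → BoundedBy N D' → HAgree D' →
    bottommostUnpairedH c D' ≡ Maybe.map rowAt (hScan (bitsOf D'))
  horizontal-scan D' bounded agree = begin
    bottommostUnpairedH c D'
      ≡⟨ scan-padded-reverse (hLo D') (hHi D') (bound-least D' bounded) (λ p b<p → beyond b<p , beyond b<p) ⟩
    proj₂ (runScan (hLo D') (hHi D') start (reverse (interval 0 N)))
      ≡⟨ cong (proj₂ ∘ runScan (hLo D') (hHi D') start) rows ⟩
    proj₂ (runScan (hLo D') (hHi D') start (upperRows ++ suc r ∷ r ∷ lowerRows))
      ≡⟨ runScan-window start upperRows (suc r) r lowerRows 0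
           (All.map (λ (r+1<p , _) → agree (>⇒≢ (<-trans (n<1+n r) r+1<p)) (>⇒≢ r+1<p)) upperRows-bounds)
           (All.map (λ p<r → agree (<⇒≢ p<r) (<⇒≢ (≤-trans p<r (n≤1+n r)))) lowerRows-bounds) ⟩
    resume hSuffix (stepAt (hLo D') (hHi D') (stepAt (hLo D') (hHi D') hPrefix (suc r)) r)
      ≡⟨ window-abstraction rowAt after (at hi) (at lo) before
           (hLo D' (suc r)) (hHi D' (suc r)) (hLo D' r) (hHi D' r) (proj₁ hSuffix)
           (pending-position rowAt after (suc (suc r)) (proj₂ hPrefix) refl) ⟩
    Maybe.map rowAt (hScan (bitsOf D')) ∎
    where
    open ≡-Reasoning
    beyond : ∀ {i p} → bound D' < p → mem D' (p , i) ≡ false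
    beyond {i} = mem-beyond-row D' i (bounded-bound D')

  cellAt : Loc → Cell
  cellAt (a , b) = rowAt a , colAt b

  move : Move → Diagram → Diagram
  move (x , y) = moveCell (cellAt x) (cellAt y)

  mem-move : ∀ {z₁ z₂ σ τ} → ZoneOf rowAt z₁ σ → ZoneOf colAt z₂ τ → ∀ mv D' →
    mem (move mv D') (z₁ , z₂) ≡ moved σ τ mv (mem D' (z₁ , z₂))
  mem-move {z₁} {z₂} {σ} {τ} zσ zτ (x , y) D' =
    trans (mem-moveCell (cellAt x) (cellAt y) D' (z₁ , z₂))
          (cong₂ (λ at-y at-x → at-y ∨ (mem D' (z₁ , z₂) ∧ not at-x)) (is-cellAt y) (is-cellAt x))
    where
    is-cellAt : ∀ l → (z₁ , z₂) ≟C cellAt l ≡ cellIs σ τ l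
    is-cellAt (a , b) = cong₂ _∧_ (zone-test zσ a) (zone-test zτ b)

  bitsOf-move : ∀ mv → bitsOf (move mv D) ≡ afterMove mv (bitsOf D)
  bitsOf-move mv = cong₄ block (bitAt lo lo) (bitAt lo hi) (bitAt hi lo) (bitAt hi hi)
    where
    bitAt : ∀ i j → mem (move mv D) (rowAt (at i) , colAt (at j))
                    ≡ moved (just (at i)) (just (at j)) mv (bit (bitsOf D) i j)
    bitAt i j = trans (mem-move (row-zone (at i)) (col-zone (at j)) mv D)
                      (cong (moved (just (at i)) (just (at j)) mv) (sym (bit-bitsOf D i j)))
    cong₄ : ∀ (f : Bool → Bool → Bool → Bool → Block) {a a' b b' c c' d d'} →
      a ≡ a' → b ≡ b' → c ≡ c' → d ≡ d' → f a b c d ≡ f a' b' c' d'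
    cong₄ f refl refl refl refl = refl

  bounded : BoundedBy N D
  bounded = BoundedBy-mono D bound≤N (bounded-bound D)

  bounded-move : ∀ mv → BoundedBy N (move mv D)
  bounded-move (x , (a , b)) =
    BoundedBy-moveCell (cellAt x) (cellAt (a , b)) D bounded (rowAt≤N a) (colAt≤N b)

  rectified raised : Zone → Diagram
  rectified t = move (rectify t) D
  raised s = move (raise s) D

  rectified-vAgree : ∀ t → VAgree (rectified t)
  rectified-vAgree t {p} p≢c p≢c+1 =
    unmoved r (≟C-col r (rowAt t) p≢c+1) (≟C-col r (rowAt t) p≢c) ,
    unmoved (suc r) (≟C-col (suc r) (rowAt t) p≢c+1) (≟C-col (suc r) (rowAt t) p≢c)
    where
    unmoved = λ row → mem-moveCell-elsewhere (rowAt t , suc c) (rowAt t , c) D (row , p)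

  raised-hAgree : ∀ s → HAgree (raised s)
  raised-hAgree s {p} p≢r p≢r+1 =
    unmoved c (≟C-row c (colAt s) p≢r+1) (≟C-row c (colAt s) p≢r) ,
    unmoved (suc c) (≟C-row (suc c) (colAt s) p≢r+1) (≟C-row (suc c) (colAt s) p≢r)
    where
    unmoved = λ col → mem-moveCell-elsewhere (suc r , colAt s) (r , colAt s) D (p , col)

  e~-via : ∀ D' →
    e~ r D' ≡ Maybe.map (λ col → moveCell (suc r , col) (r , col) D') (rightmostUnpairedV r D')
  e~-via D' with rightmostUnpairedV r D'
  ... | nothing = refl
  ... | just _  = refl

  E~-via : ∀ D' →
    E~ c D' ≡ Maybe.map (λ row → moveCell (row , suc c) (row , c) D') (bottommostUnpairedH c D')
  E~-via D' with bottommostUnpairedH c D'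
  ... | nothing = refl
  ... | just _  = refl

  e~-scan : ∀ D' → BoundedBy N D' → VAgree D' →
    e~ r D' ≡ Maybe.map (λ s → move (raise s) D') (vScan (bitsOf D'))
  e~-scan D' bounded' agree = begin
    e~ r D'
      ≡⟨ e~-via D' ⟩
    Maybe.map raiseAt (rightmostUnpairedV r D')
      ≡⟨ cong (Maybe.map raiseAt) (vertical-scan D' bounded' agree) ⟩
    Maybe.map raiseAt (Maybe.map colAt (vScan (bitsOf D')))
      ≡⟨ map-∘ {g = raiseAt} {f = colAt} (vScan (bitsOf D')) ⟨
    Maybe.map (λ s → move (raise s) D') (vScan (bitsOf D')) ∎
    where
    open ≡-Reasoning
    raiseAt : ℕ → Diagram
    raiseAt col = moveCell (suc r , col) (r , col) D'


  E~-scan : ∀ D' → BoundedBy N D' → HAgree D' →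
    E~ c D' ≡ Maybe.map (λ t → move (rectify t) D') (hScan (bitsOf D'))
  E~-scan D' bounded' agree = begin
    E~ c D'
      ≡⟨ E~-via D' ⟩
    Maybe.map rectifyAt (bottommostUnpairedH c D')
      ≡⟨ cong (Maybe.map rectifyAt) (horizontal-scan D' bounded' agree) ⟩
    Maybe.map rectifyAt (Maybe.map rowAt (hScan (bitsOf D')))
      ≡⟨ map-∘ {g = rectifyAt} {f = rowAt} (hScan (bitsOf D')) ⟨
    Maybe.map (λ t → move (rectify t) D') (hScan (bitsOf D')) ∎
    where
    open ≡-Reasoning
    rectifyAt : ℕ → Diagram
    rectifyAt row = moveCell (row , suc c) (row , c) D'


  bs : Block
  bs = bitsOf D

  e~-D : e~ r D ≡ Maybe.map raised (vScan bs)
  e~-D = e~-scan D bounded (λ _ _ → refl , refl)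

  E~-D : E~ c D ≡ Maybe.map rectified (hScan bs)
  E~-D = E~-scan D bounded (λ _ _ → refl , refl)

  e~-rectified : ∀ t →
    e~ r (rectified t) ≡ Maybe.map (λ s → move (raise s) (rectified t)) (vScan (afterMove (rectify t) bs))
  e~-rectified t =
    trans (e~-scan (rectified t) (bounded-move (rectify t)) (rectified-vAgree t))
          (cong (Maybe.map (λ s → move (raise s) (rectified t)) ∘ vScan) (bitsOf-move (rectify t)))

  E~-raised : ∀ s →
    E~ c (raised s) ≡ Maybe.map (λ t → move (rectify t) (raised s)) (hScan (afterMove (raise s) bs))
  E~-raised s =
    trans (E~-scan (raised s) (bounded-move (raise s)) (raised-hAgree s))
          (cong (Maybe.map (λ t → move (rectify t) (raised s)) ∘ hScan) (bitsOf-move (raise s)))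

  fits-mem : ∀ {z₁ z₂ σ τ} → ZoneOf rowAt z₁ σ → ZoneOf colAt z₂ τ →
    fits bs σ τ (mem D (z₁ , z₂)) ≡ true
  fits-mem {σ = nothing}                            _ _ = refl
  fits-mem {σ = just before}                        _ _ = refl
  fits-mem {σ = just after}                         _ _ = refl
  fits-mem {σ = just (at i)} {τ = nothing}          _ _ = refl
  fits-mem {σ = just (at i)} {τ = just before}      _ _ = refl
  fits-mem {σ = just (at i)} {τ = just after}       _ _ = refl
  fits-mem {σ = just (at i)} {τ = just (at j)} zσ zτ =
    trans (cong (_== bit bs i j) (trans (cong₂ (λ z₁ z₂ → mem D (z₁ , z₂)) (zoneOf-≡ zσ) (zoneOf-≡ zτ))
                                        (sym (bit-bitsOf D i j))))
          (==-refl (bit bs i j))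

  square : ∀ {s t} a b → squareAfter? bs s t a b ≡ true →
    Maybe.map (λ t' → move (rectify t') (raised s)) b ≈M Maybe.map (λ s' → move (raise s') (rectified t)) a
  square {s} {t} (just s') (just t') ok =
    ≈D-from-mem _ _ λ (z₁ , z₂) → cell z₁ z₂ (classify row-increasing z₁) (classify col-increasing z₂)
    where
    cell : ∀ z₁ z₂ → Σ (Maybe Zone) (ZoneOf rowAt z₁) → Σ (Maybe Zone) (ZoneOf colAt z₂) →
      mem (move (rectify t') (raised s)) (z₁ , z₂) ≡ mem (move (raise s') (rectified t)) (z₁ , z₂)
    cell z₁ z₂ (σ , zσ) (τ , zτ) = begin
      mem (move (rectify t') (raised s)) (z₁ , z₂)
        ≡⟨ mem-move zσ zτ (rectify t') (raised s) ⟩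
      moved σ τ (rectify t') (mem (raised s) (z₁ , z₂))
        ≡⟨ cong (moved σ τ (rectify t')) (mem-move zσ zτ (raise s) D) ⟩
      moved σ τ (rectify t') (moved σ τ (raise s) (mem D (z₁ , z₂)))
        ≡⟨ cellsCommute-sound ok σ τ (mem D (z₁ , z₂)) (fits-mem zσ zτ) ⟩
      moved σ τ (raise s') (moved σ τ (rectify t) (mem D (z₁ , z₂)))
        ≡⟨ cong (moved σ τ (raise s')) (mem-move zσ zτ (rectify t) D) ⟨
      moved σ τ (raise s') (mem (rectified t) (z₁ , z₂))
        ≡⟨ mem-move zσ zτ (raise s') (rectified t) ⟨
      mem (move (raise s') (rectified t)) (z₁ , z₂) ∎
      where open ≡-Reasoning

  Claim : Maybe Diagram → Maybe Diagram → Set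
  Claim ED eD =
      (NonZero ED → (NonZero eD ⇔ NonZero (ED >>=D e~ r)))
    × (NonZero eD → (NonZero ED ⇔ NonZero (eD >>=D E~ c)))
    × (NonZero ED → NonZero eD → (eD >>=D E~ c) ≈M (ED >>=D e~ r))

  claim : ∀ a b →
    raiseAfterRectify? vScan bs a b ∧ rectifyAfterRaise? hScan bs a b ∧ square? vScan hScan bs a b ≡ true →
    Claim (Maybe.map rectified b) (Maybe.map raised a)
  claim a b ok with ∧-split (raiseAfterRectify? vScan bs a b) ok
  ... | ok₁ , ok₂₃ with ∧-split (rectifyAfterRaise? hScan bs a b) ok₂₃
  ...   | ok₂ , ok₃ = part₁ a b ok₁ , part₂ a b ok₂ , part₃ a b ok₃
    where
    part₁ : ∀ a b → raiseAfterRectify? vScan bs a b ≡ true → NonZero (Maybe.map rectified b) →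
      NonZero (Maybe.map raised a) ⇔ NonZero (Maybe.map rectified b >>=D e~ r)
    part₁ a (just t) ok _ rewrite e~-rectified t = nonZero-map-⇔ raised _ a _ (==-sound ok)

    part₂ : ∀ a b → rectifyAfterRaise? hScan bs a b ≡ true → NonZero (Maybe.map raised a) →
      NonZero (Maybe.map rectified b) ⇔ NonZero (Maybe.map raised a >>=D E~ c)
    part₂ (just s) b ok _ rewrite E~-raised s = nonZero-map-⇔ rectified _ b _ (==-sound ok)

    part₃ : ∀ a b → square? vScan hScan bs a b ≡ true →
      NonZero (Maybe.map rectified b) → NonZero (Maybe.map raised a) →
      (Maybe.map raised a >>=D E~ c) ≈M (Maybe.map rectified b >>=D e~ r)
    part₃ (just s) (just t) ok _ _ rewrite E~-raised s | e~-rectified t =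
      square {s} {t} (vScan (afterMove (rectify t) bs)) (hScan (afterMove (raise s) bs)) ok

  theorem : Claim (E~ c D) (e~ r D)
  theorem = subst₂ Claim (sym E~-D) (sym e~-D)
    (claim (vScan bs) (hScan bs) (commutes vPrefix (proj₁ vSuffix) hPrefix (proj₁ hSuffix) bs))

theorem5p33 : (D : Diagram) → IsDiagram D → (r c : ℕ) → 1 ≤ r → 1 ≤ c →
    (NonZero (E~ c D) → (NonZero (e~ r D) ⇔ NonZero (E~ c D >>=D e~ r)))
    × (NonZero (e~ r D) → (NonZero (E~ c D) ⇔ NonZero (e~ r D >>=D E~ c)))
    × (NonZero (E~ c D) → NonZero (e~ r D) →
    (e~ r D >>=D E~ c) ≈M (E~ c D >>=D e~ r))
theorem5p33 D _ (suc r₀) (suc c₀) (s≤s z≤n) (s≤s z≤n) = Crossing.theorem D r₀ c₀
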